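{- Let $n\ge5$ be an odd integer and let $S\subseteq \mathbb{Z}_n\setminus\{0\}$ satisfy $-S=S$, $1\in S$, $|S|\ge 4$, and either $S\cap\{2,3\}=\emptyset$ or $|S|\ge 6$. Let $\Gamma=\mathrm{Circ}(n;S)$ and let $a\in\mathbb{Z}_n$ with $2\le a\le (n-1)/2$ be such that $\Gamma-\{0,1,a,a+1\}$ has no fractional perfect matching. Then $a$ is odd and there is no odd $s\in S$ with $1<s\le (n-1)/2$.
   Context: Elements of $\mathbb{Z}_n$ are identified with the integers $0,1,\dots,n-1$, and inequalities and parity refer to these representatives. $\mathrm{Circ}(n;S)$ is the graph with vertex set $\mathbb{Z}_n$ in which $i$ is adjacent to $i+s$ for each $s\in S$. For a vertex set $U$, $\Gamma-U$ is the subgraph induced on the remaining vertices. A fractional perfect matching of a graph $(V,E)$ is a function $f:E\to[0,1]$ such that for every vertex $v$ the sum of $f(e)$ over edges incident to $v$ equals $1$. -}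

module Defs where

open import Data.Nat using (ℕ; NonZero; _∸_) renaming (_+_ to _+ℕ_)
open import Data.Nat.DivMod using (_mod_)
open import Data.Fin using (Fin; toℕ; zero; suc)
open import Data.Fin.Subset using (Subset; _∈_; _∉_)
open import Data.Fin.Subset.Properties using (_∈?_)
open import Data.Rational using (ℚ; 0ℚ; 1ℚ; _+_; _≤_)
open import Data.Product using (Σ; _×_)
open import Data.Sum using (_⊎_)
open import Relation.Binary.PropositionalEquality using (_≡_)
open import Relation.Nullary using (Dec; yes; no; ¬_)
open import Relation.Nullary.Decidable using (_×-dec_; _⊎-dec_; ¬?)

-- Z_n is represented by Fin n (representatives 0..n-1).
module _ {n : ℕ} ⦃ _ : NonZero n ⦄ where

  [_]ₙ : ℕ → Fin n
  [ k ]ₙ = k mod n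

  _⊕_ : Fin n → Fin n → Fin n
  i ⊕ j = (toℕ i +ℕ toℕ j) mod n

  _⊖_ : Fin n → Fin n → Fin n
  i ⊖ j = (toℕ i +ℕ (n ∸ toℕ j)) mod n

  ⊝_ : Fin n → Fin n
  ⊝ i = (n ∸ toℕ i) mod n

  Adj : Subset n → Fin n → Fin n → Set
  Adj S i j = ((j ⊖ i) ∈ S) ⊎ ((i ⊖ j) ∈ S)

  adj? : (S : Subset n) (i j : Fin n) → Dec (Adj S i j)
  adj? S i j = ((j ⊖ i) ∈? S) ⊎-dec ((i ⊖ j) ∈? S)

sumℚ : ∀ {m} → (Fin m → ℚ) → ℚ
sumℚ {ℕ.zero} f = 0ℚ
sumℚ {ℕ.suc m} f = f zero + sumℚ (λ i → f (suc i))

when : ∀ {p} {P : Set p} → Dec P → ℚ → ℚ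
when (yes _) x = x
when (no _) x = 0ℚ

-- Γ - U for Γ = Circ(n;S): vertices outside U, edges {i,j} with i,j ∉ U adjacent in Γ.
-- A fractional perfect matching is a weight function on (unordered) edges, represented
-- as a symmetric function f on pairs (values on non-edges are irrelevant),
-- with values in [0,1] on edges and total weight 1 at each vertex.
HasFPM : (n : ℕ) ⦃ _ : NonZero n ⦄ → Subset n → Subset n → Set
HasFPM n S U =
  Σ (Fin n → Fin n → ℚ) λ f →
    (∀ i j → f i j ≡ f j i)
    × (∀ i j → i ∉ U → j ∉ U → Adj S i j → (0ℚ ≤ f i j) × (f i j ≤ 1ℚ))
    × (∀ v → v ∉ U →
         sumℚ (λ u → when ((¬? (u ∈? U)) ×-dec adj? S v u) (f v u)) ≡ 1ℚ)

{-# OPTIONS --safe #-}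
module Submission where

-- A permutation σ of ℤ_n that maps U = {0, 1, a, a+1} to itself and moves every other vertex
-- to a neighbour outside U yields a fractional perfect matching of Γ − U: weight ½ on each
-- edge {v, σ v}, so weight 1 on 2-cycles.  Deleting U from the Hamiltonian cycle 0, 1, …, n−1
-- leaves two paths with a − 2 and n − a − 2 vertices, exactly one of odd size, so it suffices
-- to find one odd cycle through chords of a single length s ∈ S, 2 ≤ s ≤ (n−1)/2, whose
-- complement splits into pairs of consecutive vertices.  For even s one chord closes a run of
-- s + 1 vertices; for odd s two chords, one jumping over {a, a+1} and one over {0, 1}, close a
-- cycle of n − 2s + 2 vertices winding once around ℤ_n.  The latter works for every odd a and
-- odd s; for even a the hypotheses on S provide a suitable s (the boundary case
-- s = a = (n−1)/2 needs a 5-cycle with two chords).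

open import Defs
open import Data.Fin.Base using (Fin; toℕ; fromℕ<)
import Data.Fin.Properties as Fin
open import Data.Fin.Properties using (toℕ-injective; toℕ-fromℕ<; toℕ<n; any?)
open import Data.Fin.Subset using (Subset; _∈_; _∉_; ⁅_⁆; _∪_; ∣_∣)
open import Data.Fin.Subset.Properties
  using (_∈?_; x∈p∪q⁻; x∈p∪q⁺; x∈⁅x⁆; x∈⁅y⁆⇒x≡y; ∣⁅x⁆∣≡1; p⊆q⇒∣p∣≤∣q∣; ∣p∣≤n)
open import Data.List.Base using ([]; _∷_)
open import Data.Nat.Base hiding (parity)
open import Data.Nat.DivMod
open import Data.Nat.Properties
open import Data.Nat.Tactic.RingSolver using (solve-∀; solve)
open import Data.Product.Base using (Σ; Σ-syntax; ∃; _×_; _,_; proj₁; proj₂)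
open import Data.Sum.Base using (_⊎_; inj₁; inj₂)
open import Function.Base using (_∘_)
open import Relation.Binary.PropositionalEquality
open import Relation.Nullary using (Dec; yes; no; ¬_; contradiction)
open import Relation.Nullary.Decidable using (_×-dec_; ¬?)

module FractionalMatching where

  open import Algebra.Bundles using (CommutativeMonoid)
  open import Data.Fin.Base using (zero; suc)
  import Data.Rational as ℚ
  open import Data.Rational using (ℚ; 0ℚ; 1ℚ; ½)
  import Data.Rational.Properties as ℚₚ
  open import Algebra.Properties.CommutativeSemigroup
    (CommutativeMonoid.commutativeSemigroup ℚₚ.+-0-commutativeMonoid) using (interchange)
  open import Relation.Nullary.Decidable using (from-yes)

  sumℚ-cong : ∀ {m} {f g : Fin m → ℚ} → (∀ i → f i ≡ g i) → sumℚ f ≡ sumℚ g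
  sumℚ-cong {zero}  f≡g = refl
  sumℚ-cong {suc m} f≡g = cong₂ ℚ._+_ (f≡g zero) (sumℚ-cong (λ i → f≡g (suc i)))

  sumℚ-+ : ∀ {m} (f g : Fin m → ℚ) → sumℚ (λ i → f i ℚ.+ g i) ≡ sumℚ f ℚ.+ sumℚ g
  sumℚ-+ {zero}  f g = refl
  sumℚ-+ {suc m} f g =
    trans (cong (f zero ℚ.+ g zero ℚ.+_) (sumℚ-+ (λ i → f (suc i)) (λ i → g (suc i))))
          (interchange (f zero) (g zero) _ _)

  sumℚ-0 : ∀ {m} → sumℚ {m} (λ _ → 0ℚ) ≡ 0ℚ
  sumℚ-0 {zero}  = refl
  sumℚ-0 {suc m} = cong (0ℚ ℚ.+_) (sumℚ-0 {m})

  when-cong : ∀ {P Q : Set} (p : Dec P) (q : Dec Q) {x} → (P → Q) → (Q → P) → when p x ≡ when q x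
  when-cong (yes _) (yes _) P→Q Q→P = refl
  when-cong (no _)  (no _)  P→Q Q→P = refl
  when-cong (yes p) (no ¬q) P→Q Q→P = contradiction (P→Q p) ¬q
  when-cong (no ¬p) (yes q) P→Q Q→P = contradiction (Q→P q) ¬p

  when-no : ∀ {P : Set} (p : Dec P) {x} → ¬ P → when p x ≡ 0ℚ
  when-no (yes p) ¬p = contradiction p ¬p
  when-no (no _)  ¬p = refl

  when-absorb : ∀ {P : Set} (p : Dec P) {x} → (¬ P → x ≡ 0ℚ) → when p x ≡ x
  when-absorb (yes _) x≡0 = refl
  when-absorb (no ¬p) x≡0 = sym (x≡0 ¬p)

  sumℚ-indicator : ∀ {m} (w : Fin m) x → sumℚ (λ u → when (u Fin.≟ w) x) ≡ x
  sumℚ-indicator {suc m} zero x = trans (cong (x ℚ.+_) (trans rest-0 (sumℚ-0 {m}))) (ℚₚ.+-identityʳ x)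
    where
    rest-0 : sumℚ {m} (λ i → when (suc i Fin.≟ zero) x) ≡ sumℚ {m} (λ _ → 0ℚ)
    rest-0 = sumℚ-cong {m} (λ i → when-no (suc i Fin.≟ zero) {x} λ ())
  sumℚ-indicator (suc w) x = trans (cong (0ℚ ℚ.+_) (trans shift (sumℚ-indicator w x))) (ℚₚ.+-identityˡ x)
    where
    shift : sumℚ (λ i → when (suc i Fin.≟ suc w) x) ≡ sumℚ (λ i → when (i Fin.≟ w) x)
    shift = sumℚ-cong (λ i → when-cong (suc i Fin.≟ suc w) (i Fin.≟ w) Fin.suc-injective (cong suc))

  when-½-+-bounds : ∀ {P Q : Set} (p : Dec P) (q : Dec Q) →
                    0ℚ ℚ.≤ when p ½ ℚ.+ when q ½ × when p ½ ℚ.+ when q ½ ℚ.≤ 1ℚ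
  when-½-+-bounds (yes _) (yes _) = from-yes (0ℚ ℚ.≤? ½ ℚ.+ ½)   , from-yes (½ ℚ.+ ½ ℚ.≤? 1ℚ)
  when-½-+-bounds (yes _) (no _)  = from-yes (0ℚ ℚ.≤? ½ ℚ.+ 0ℚ)  , from-yes (½ ℚ.+ 0ℚ ℚ.≤? 1ℚ)
  when-½-+-bounds (no _)  (yes _) = from-yes (0ℚ ℚ.≤? 0ℚ ℚ.+ ½)  , from-yes (0ℚ ℚ.+ ½ ℚ.≤? 1ℚ)
  when-½-+-bounds (no _)  (no _)  = from-yes (0ℚ ℚ.≤? 0ℚ ℚ.+ 0ℚ) , from-yes (0ℚ ℚ.+ 0ℚ ℚ.≤? 1ℚ)

  Adj-sym : ∀ {n} ⦃ _ : NonZero n ⦄ {S : Subset n} {v w} → Adj S v w → Adj S w v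
  Adj-sym (inj₁ x) = inj₂ x
  Adj-sym (inj₂ x) = inj₁ x

  module _ {n : ℕ} ⦃ _ : NonZero n ⦄ (S U : Subset n) (σ τ : Fin n → Fin n)
    (σ∘τ : ∀ v → σ (τ v) ≡ v) (τ∘σ : ∀ v → τ (σ v) ≡ v)
    (σ-∈U : ∀ {v} → v ∈ U → σ v ∈ U) (σ-∉U : ∀ {v} → v ∉ U → σ v ∉ U)
    (σ-Adj : ∀ {v} → v ∉ U → Adj S v (σ v)) where

    cycleWeight : Fin n → Fin n → ℚ
    cycleWeight v u = when (u Fin.≟ σ v) ½ ℚ.+ when (u Fin.≟ τ v) ½

    private
      τ-∉U : ∀ {v} → v ∉ U → τ v ∉ U
      τ-∉U {v} v∉U τv∈U = v∉U (subst (_∈ U) (σ∘τ v) (σ-∈U τv∈U))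

      τ-Adj : ∀ {v} → v ∉ U → Adj S v (τ v)
      τ-Adj {v} v∉U = Adj-sym {S = S} {τ v} {v} (subst (Adj S (τ v)) (σ∘τ v) (σ-Adj (τ-∉U v∉U)))

      cycleWeight-sym : ∀ v u → cycleWeight v u ≡ cycleWeight u v
      cycleWeight-sym v u = trans
        (cong₂ ℚ._+_
          (when-cong (u Fin.≟ σ v) (v Fin.≟ τ u) (λ { refl → sym (τ∘σ v) }) (λ { refl → sym (σ∘τ u) }))
          (when-cong (u Fin.≟ τ v) (v Fin.≟ σ u) (λ { refl → sym (σ∘τ v) }) (λ { refl → sym (τ∘σ u) })))
        (ℚₚ.+-comm (when (v Fin.≟ τ u) ½) (when (v Fin.≟ σ u) ½))

      cycleWeight-outside : ∀ {v} u → v ∉ U → ¬ (u ∉ U × Adj S v u) → cycleWeight v u ≡ 0ℚ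
      cycleWeight-outside {v} u v∉U ¬edge = cong₂ ℚ._+_
        (when-no (u Fin.≟ σ v) λ { refl → ¬edge (σ-∉U v∉U , σ-Adj v∉U) })
        (when-no (u Fin.≟ τ v) λ { refl → ¬edge (τ-∉U v∉U , τ-Adj v∉U) })

      cycleWeight-total : ∀ {v} → v ∉ U →
        sumℚ (λ u → when ((¬? (u ∈? U)) ×-dec adj? S v u) (cycleWeight v u)) ≡ 1ℚ
      cycleWeight-total {v} v∉U = begin
        sumℚ (λ u → when ((¬? (u ∈? U)) ×-dec adj? S v u) (cycleWeight v u))
          ≡⟨ sumℚ-cong (λ u → when-absorb (¬? (u ∈? U) ×-dec adj? S v u) (cycleWeight-outside u v∉U)) ⟩
        sumℚ (cycleWeight v)
          ≡⟨ sumℚ-+ (λ u → when (u Fin.≟ σ v) ½) (λ u → when (u Fin.≟ τ v) ½) ⟩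
        sumℚ (λ u → when (u Fin.≟ σ v) ½) ℚ.+ sumℚ (λ u → when (u Fin.≟ τ v) ½)
          ≡⟨ cong₂ ℚ._+_ (sumℚ-indicator (σ v) ½) (sumℚ-indicator (τ v) ½) ⟩
        ½ ℚ.+ ½ ∎
        where open ≡-Reasoning

    cycleCover⇒HasFPM : HasFPM n S U
    cycleCover⇒HasFPM =
      cycleWeight , cycleWeight-sym , (λ v u _ _ _ → when-½-+-bounds (u Fin.≟ σ v) (u Fin.≟ τ v)) ,
      λ _ → cycleWeight-total

module IntervalPermutation where

  infix 4 _∈[_,_⟩
  _∈[_,_⟩ : ℕ → ℕ → ℕ → Set
  x ∈[ l , r ⟩ = l ≤ x × x < r

  -- σ and τ are mutually inverse bijections of [l, r); their values elsewhere are irrelevant.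
  record Perm (l r : ℕ) : Set where
    field
      l≤r : l ≤ r
      σ τ : ℕ → ℕ
      σ-∈ : ∀ {x} → x ∈[ l , r ⟩ → σ x ∈[ l , r ⟩
      τ-∈ : ∀ {x} → x ∈[ l , r ⟩ → τ x ∈[ l , r ⟩
      σ-τ : ∀ {x} → x ∈[ l , r ⟩ → σ (τ x) ≡ x
      τ-σ : ∀ {x} → x ∈[ l , r ⟩ → τ (σ x) ≡ x
  open Perm public

  AllSteps : ∀ {l r} → (ℕ → ℕ → Set) → Perm l r → Set
  AllSteps {l} {r} R π = ∀ {x} → x ∈[ l , r ⟩ → R x (σ π x)

  private
    variable
      l m r u v x : ℕ

  _⁻¹ : Perm l r → Perm l r
  π ⁻¹ = record
    { l≤r = l≤r π ; σ = τ π ; τ = σ π ; σ-∈ = τ-∈ π ; τ-∈ = σ-∈ π ; σ-τ = τ-σ π ; τ-σ = σ-τ π }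

  _∘ₚ_ : Perm l r → Perm l r → Perm l r
  π ∘ₚ ρ = record
    { l≤r = l≤r π ; σ = σ π ∘ σ ρ ; τ = τ ρ ∘ τ π
    ; σ-∈ = σ-∈ π ∘ σ-∈ ρ ; τ-∈ = τ-∈ ρ ∘ τ-∈ π
    ; σ-τ = λ x∈ → trans (cong (σ π) (σ-τ ρ (τ-∈ π x∈))) (σ-τ π x∈)
    ; τ-σ = λ x∈ → trans (cong (τ ρ) (τ-σ π (σ-∈ ρ x∈))) (τ-σ ρ x∈)
    }

  ∅ₚ : ∀ l → Perm l l
  ∅ₚ l = record
    { l≤r = ≤-refl ; σ = λ x → x ; τ = λ x → x
    ; σ-∈ = λ x∈ → x∈ ; τ-∈ = λ x∈ → x∈ ; σ-τ = λ _ → refl ; τ-σ = λ _ → refl }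

  swap : ℕ → ℕ → ℕ → ℕ
  swap u v x with x ≟ u | x ≟ v
  ... | yes _ | _     = v
  ... | no _  | yes _ = u
  ... | no _  | no _  = x

  swap-cases : ∀ u v x →
    (x ≡ u × swap u v x ≡ v) ⊎ (x ≡ v × swap u v x ≡ u) ⊎ (x ≢ u × x ≢ v × swap u v x ≡ x)
  swap-cases u v x with x ≟ u
  ... | yes refl = inj₁ (refl , refl)
  ... | no x≢u with x ≟ v
  ...   | yes refl = inj₂ (inj₁ (refl , refl))
  ...   | no x≢v   = inj₂ (inj₂ (x≢u , x≢v , refl))

  swap-u : ∀ u v → swap u v u ≡ v
  swap-u u v with swap-cases u v u
  ... | inj₁ (_ , e)                = e
  ... | inj₂ (inj₁ (u≡v , e))       = trans e u≡v
  ... | inj₂ (inj₂ (u≢u , _ , _))   = contradiction refl u≢u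

  swap-v : ∀ u v → swap u v v ≡ u
  swap-v u v with swap-cases u v v
  ... | inj₁ (v≡u , e)              = trans e v≡u
  ... | inj₂ (inj₁ (_ , e))         = e
  ... | inj₂ (inj₂ (_ , v≢v , _))   = contradiction refl v≢v

  swap-involutive : ∀ u v x → swap u v (swap u v x) ≡ x
  swap-involutive u v x with swap-cases u v x
  ... | inj₁ (refl , e)             = trans (cong (swap u v) e) (swap-v u v)
  ... | inj₂ (inj₁ (refl , e))      = trans (cong (swap u v) e) (swap-u u v)
  ... | inj₂ (inj₂ (_ , _ , e))     = trans (cong (swap u v) e) e

  swap-∈ : u ∈[ l , r ⟩ → v ∈[ l , r ⟩ → x ∈[ l , r ⟩ → swap u v x ∈[ l , r ⟩
  swap-∈ {u} {l} {r} {v} {x} u∈ v∈ x∈ with swap-cases u v x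
  ... | inj₁ (_ , e)                = subst (_∈[ l , r ⟩) (sym e) v∈
  ... | inj₂ (inj₁ (_ , e))         = subst (_∈[ l , r ⟩) (sym e) u∈
  ... | inj₂ (inj₂ (_ , _ , e))     = subst (_∈[ l , r ⟩) (sym e) x∈

  transposition : u ∈[ l , r ⟩ → v ∈[ l , r ⟩ → Perm l r
  transposition {u} {l} {r} {v} u∈ v∈ = record
    { l≤r = ≤-trans (proj₁ u∈) (<⇒≤ (proj₂ u∈)) ; σ = swap u v ; τ = swap u v
    ; σ-∈ = swap-∈ u∈ v∈ ; τ-∈ = swap-∈ u∈ v∈
    ; σ-τ = λ {x} _ → swap-involutive u v x ; τ-σ = λ {x} _ → swap-involutive u v x }

  piecewise : ℕ → (ℕ → ℕ) → (ℕ → ℕ) → ℕ → ℕ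
  piecewise m f g x with x <? m
  ... | yes _ = f x
  ... | no _  = g x

  piecewise-< : ∀ {f g} → x < m → piecewise m f g x ≡ f x
  piecewise-< {x} {m} x<m with x <? m
  ... | yes _   = refl
  ... | no x≮m  = contradiction x<m x≮m

  piecewise-≥ : ∀ {f g} → m ≤ x → piecewise m f g x ≡ g x
  piecewise-≥ {m} {x} m≤x with x <? m
  ... | yes x<m = contradiction m≤x (<⇒≱ x<m)
  ... | no _    = refl

  split : ∀ m → x ∈[ l , r ⟩ → x ∈[ l , m ⟩ ⊎ x ∈[ m , r ⟩
  split {x} m (l≤x , x<r) with x <? m
  ... | yes x<m = inj₁ (l≤x , x<m)
  ... | no x≮m  = inj₂ (≮⇒≥ x≮m , x<r)

  module _ {l m r : ℕ} (l≤m : l ≤ m) (m≤r : m ≤ r) where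

    piecewise-∈ : ∀ {f g} →
      (∀ {x} → x ∈[ l , m ⟩ → f x ∈[ l , m ⟩) → (∀ {x} → x ∈[ m , r ⟩ → g x ∈[ m , r ⟩) →
      x ∈[ l , r ⟩ → piecewise m f g x ∈[ l , r ⟩
    piecewise-∈ {x} {f} {g} f-∈ g-∈ x∈ with split m x∈
    ... | inj₁ x∈ˡ = subst (_∈[ l , r ⟩) (sym (piecewise-< (proj₂ x∈ˡ)))
                           (proj₁ (f-∈ x∈ˡ) , ≤-trans (proj₂ (f-∈ x∈ˡ)) m≤r)
    ... | inj₂ x∈ʳ = subst (_∈[ l , r ⟩) (sym (piecewise-≥ (proj₁ x∈ʳ)))
                           (≤-trans l≤m (proj₁ (g-∈ x∈ʳ)) , proj₂ (g-∈ x∈ʳ))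

    piecewise-inverse : ∀ {f g f′ g′} →
      (∀ {x} → x ∈[ l , m ⟩ → f′ x ∈[ l , m ⟩) → (∀ {x} → x ∈[ m , r ⟩ → g′ x ∈[ m , r ⟩) →
      (∀ {x} → x ∈[ l , m ⟩ → f (f′ x) ≡ x) → (∀ {x} → x ∈[ m , r ⟩ → g (g′ x) ≡ x) →
      x ∈[ l , r ⟩ → piecewise m f g (piecewise m f′ g′ x) ≡ x
    piecewise-inverse {x} {f} {g} {f′} {g′} f′-∈ g′-∈ ff′ gg′ x∈ with split m x∈
    ... | inj₁ x∈ˡ = begin
      piecewise m f g (piecewise m f′ g′ x) ≡⟨ cong (piecewise m f g) (piecewise-< (proj₂ x∈ˡ)) ⟩
      piecewise m f g (f′ x)                ≡⟨ piecewise-< (proj₂ (f′-∈ x∈ˡ)) ⟩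
      f (f′ x)                              ≡⟨ ff′ x∈ˡ ⟩
      x                                     ∎
      where open ≡-Reasoning
    ... | inj₂ x∈ʳ = begin
      piecewise m f g (piecewise m f′ g′ x) ≡⟨ cong (piecewise m f g) (piecewise-≥ (proj₁ x∈ʳ)) ⟩
      piecewise m f g (g′ x)                ≡⟨ piecewise-≥ (proj₁ (g′-∈ x∈ʳ)) ⟩
      g (g′ x)                              ≡⟨ gg′ x∈ʳ ⟩
      x                                     ∎
      where open ≡-Reasoning

  infixr 5 _++ₚ_
  _++ₚ_ : Perm l m → Perm m r → Perm l r
  _++ₚ_ {l} {m} {r} π ρ = record
    { l≤r = ≤-trans (l≤r π) (l≤r ρ)
    ; σ = piecewise m (σ π) (σ ρ) ; τ = piecewise m (τ π) (τ ρ)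
    ; σ-∈ = piecewise-∈ (l≤r π) (l≤r ρ) (σ-∈ π) (σ-∈ ρ)
    ; τ-∈ = piecewise-∈ (l≤r π) (l≤r ρ) (τ-∈ π) (τ-∈ ρ)
    ; σ-τ = piecewise-inverse (l≤r π) (l≤r ρ) (τ-∈ π) (τ-∈ ρ) (σ-τ π) (σ-τ ρ)
    ; τ-σ = piecewise-inverse (l≤r π) (l≤r ρ) (σ-∈ π) (σ-∈ ρ) (τ-σ π) (τ-σ ρ)
    }

  ++-σˡ : ∀ (π : Perm l m) (ρ : Perm m r) → x < m → σ (π ++ₚ ρ) x ≡ σ π x
  ++-σˡ π ρ = piecewise-< {f = σ π} {g = σ ρ}

  ++-σʳ : ∀ (π : Perm l m) (ρ : Perm m r) → m ≤ x → σ (π ++ₚ ρ) x ≡ σ ρ x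
  ++-σʳ π ρ = piecewise-≥ {f = σ π} {g = σ ρ}

  AllSteps-++ : ∀ {R} (π : Perm l m) (ρ : Perm m r) →
                AllSteps R π → AllSteps R ρ → AllSteps R (π ++ₚ ρ)
  AllSteps-++ {l} {m} {r} {R} π ρ Rπ Rρ {x} x∈ with split m x∈
  ... | inj₁ x∈ˡ = subst (R x) (sym (++-σˡ π ρ (proj₂ x∈ˡ))) (Rπ x∈ˡ)
  ... | inj₂ x∈ʳ = subst (R x) (sym (++-σʳ π ρ (proj₁ x∈ʳ))) (Rρ x∈ʳ)

  module _ {l m : ℕ} where

    private
      σ′ τ′ : ℕ → ℕ
      σ′ = piecewise m suc (λ _ → l)
      τ′ = piecewise (suc l) (λ _ → m) pred

      rotate-σ-< : x < m → σ′ x ≡ suc x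
      rotate-σ-< = piecewise-<

      rotate-σ-last : σ′ m ≡ l
      rotate-σ-last = piecewise-≥ {m} {m} {suc} ≤-refl

      rotate-τ-> : l < x → τ′ x ≡ pred x
      rotate-τ-> = piecewise-≥

      rotate-τ-first : τ′ l ≡ m
      rotate-τ-first = piecewise-< {l} {suc l} {λ _ → m} (n<1+n l)

    rotation : l ≤ m → Perm l (suc m)
    rotation l≤m = record
      { l≤r = m≤n⇒m≤1+n l≤m
      ; σ = σ′ ; τ = τ′ ; σ-∈ = σ-∈′ ; τ-∈ = τ-∈′ ; σ-τ = σ-τ′ ; τ-σ = τ-σ′ }
      where
      below-or-last : x ∈[ l , suc m ⟩ → x < m ⊎ x ≡ m
      below-or-last (_ , x<1+m) = m≤n⇒m<n∨m≡n (s≤s⁻¹ x<1+m)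

      first-or-above : x ∈[ l , suc m ⟩ → x ≡ l ⊎ l < x
      first-or-above (l≤x , _) with m≤n⇒m<n∨m≡n l≤x
      ... | inj₁ l<x = inj₂ l<x
      ... | inj₂ l≡x = inj₁ (sym l≡x)

      σ-∈′ : x ∈[ l , suc m ⟩ → σ′ x ∈[ l , suc m ⟩
      σ-∈′ x∈@(l≤x , _) with below-or-last x∈
      ... | inj₁ x<m  = subst (_∈[ l , suc m ⟩) (sym (rotate-σ-< x<m)) (m≤n⇒m≤1+n l≤x , s≤s x<m)
      ... | inj₂ refl = subst (_∈[ l , suc m ⟩) (sym rotate-σ-last) (≤-refl , s≤s l≤m)

      τ-∈′ : x ∈[ l , suc m ⟩ → τ′ x ∈[ l , suc m ⟩
      τ-∈′ x∈@(_ , x<1+m) with first-or-above x∈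
      ... | inj₁ refl = subst (_∈[ l , suc m ⟩) (sym rotate-τ-first) (l≤m , n<1+n m)
      ... | inj₂ l<x@(s≤s l≤y) =
        subst (_∈[ l , suc m ⟩) (sym (rotate-τ-> l<x)) (l≤y , m<n⇒m<1+n (s≤s⁻¹ x<1+m))

      σ-τ′ : x ∈[ l , suc m ⟩ → σ′ (τ′ x) ≡ x
      σ-τ′ x∈@(_ , x<1+m) with first-or-above x∈
      ... | inj₁ refl = trans (cong σ′ rotate-τ-first) rotate-σ-last
      ... | inj₂ l<x@(s≤s _) = trans (cong σ′ (rotate-τ-> l<x)) (rotate-σ-< (s≤s⁻¹ x<1+m))

      τ-σ′ : x ∈[ l , suc m ⟩ → τ′ (σ′ x) ≡ x
      τ-σ′ x∈@(l≤x , _) with below-or-last x∈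
      ... | inj₁ x<m  = trans (cong τ′ (rotate-σ-< x<m)) (rotate-τ-> (s≤s l≤x))
      ... | inj₂ refl = trans (cong τ′ rotate-σ-last) rotate-τ-first

    module _ (l≤m : l ≤ m) where

      rotation-σ-< : x < m → σ (rotation l≤m) x ≡ suc x
      rotation-σ-< = rotate-σ-<

      rotation-σ-last : σ (rotation l≤m) m ≡ l
      rotation-σ-last = rotate-σ-last

      rotation-τ-> : l < x → τ (rotation l≤m) x ≡ pred x
      rotation-τ-> = rotate-τ->

      rotation-τ-first : τ (rotation l≤m) l ≡ m
      rotation-τ-first = rotate-τ-first

module CycleCover (P : ℕ → Set) (G : ℕ → ℕ → Set) where

  open IntervalPermutation

  private
    variable
      l m r p u w v x y : ℕ

  Admissible : ℕ → ℕ → Set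
  Admissible x y = (P x → P y) × (¬ P x → ¬ P y × G x y)

  admissible-edge : ¬ P x → ¬ P y → G x y → Admissible x y
  admissible-edge ¬Px ¬Py Gxy = (λ Px → contradiction Px ¬Px) , λ _ → ¬Py , Gxy

  admissible-removed : P x → P y → Admissible x y
  admissible-removed Px Py = (λ _ → Py) , λ ¬Px → contradiction Px ¬Px

  Avoids : ℕ → ℕ → Set
  Avoids l r = ∀ {x} → x ∈[ l , r ⟩ → ¬ P x

  avoids-mono : l ≤ m → v ≤ r → Avoids l r → Avoids m v
  avoids-mono l≤m v≤r avoid (m≤x , x<v) = avoid (≤-trans l≤m m≤x , <-≤-trans x<v v≤r)

  Cover : ℕ → ℕ → Set
  Cover l r = Σ (Perm l r) (AllSteps Admissible)

  ∅ᶜ : ∀ l → Cover l l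
  ∅ᶜ l = ∅ₚ l , λ (l≤x , x<l) → contradiction l≤x (<⇒≱ x<l)

  infixr 5 _++ᶜ_
  _++ᶜ_ : Cover l m → Cover m r → Cover l r
  (π , π-adm) ++ᶜ (ρ , ρ-adm) = π ++ₚ ρ , AllSteps-++ {R = Admissible} π ρ π-adm ρ-adm

  castᶜ : l ≡ m → r ≡ v → Cover l r → Cover m v
  castᶜ refl refl c = c

  -- Swapping the successors of u and v joins their cycles into one.
  merge : (π : Perm l r) → u ∈[ l , r ⟩ → v ∈[ l , r ⟩ →
          (∀ {x} → x ∈[ l , r ⟩ → x ≢ u → x ≢ v → Admissible x (σ π x)) →
          Admissible u (σ π v) → Admissible v (σ π u) → Cover l r
  merge {u = u} {v = v} π u∈ v∈ steps u↦ v↦ = π ∘ₚ transposition u∈ v∈ , steps′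
    where
    steps′ : AllSteps Admissible (π ∘ₚ transposition u∈ v∈)
    steps′ {x} x∈ with swap-cases u v x
    ... | inj₁ (refl , e)           = subst (Admissible u ∘ σ π) (sym e) u↦
    ... | inj₂ (inj₁ (refl , e))    = subst (Admissible v ∘ σ π) (sym e) v↦
    ... | inj₂ (inj₂ (x≢u , x≢v , e)) = subst (Admissible x ∘ σ π) (sym e) (steps x∈ x≢u x≢v)

  module Runs (G-suc : ∀ x → G x (suc x)) (G-pred : ∀ x → G (suc x) x) where

    run-steps : (l≤m : l ≤ m) → Avoids l (suc m) →
                x ∈[ l , suc m ⟩ → x ≢ m → Admissible x (σ (rotation l≤m) x)
    run-steps {x = x} l≤m avoid x∈@(l≤x , x<1+m) x≢m =
      subst (Admissible x) (sym (rotation-σ-< l≤m x<m))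
            (admissible-edge (avoid x∈) (avoid (m≤n⇒m≤1+n l≤x , s≤s x<m)) (G-suc x))
      where
      x<m = ≤∧≢⇒< (s≤s⁻¹ x<1+m) x≢m

    run↓-steps : (l≤m : l ≤ m) → Avoids l (suc m) →
                 x ∈[ l , suc m ⟩ → x ≢ l → Admissible x (τ (rotation l≤m) x)
    run↓-steps {l} {x = suc y} l≤m avoid x∈@(l≤x , x<1+m) x≢l =
      subst (Admissible (suc y)) (sym (rotation-τ-> l≤m l<x))
            (admissible-edge (avoid x∈) (avoid (s≤s⁻¹ l<x , m<n⇒m<1+n (s≤s⁻¹ x<1+m))) (G-pred y))
      where
      l<x = ≤∧≢⇒< l≤x (x≢l ∘ sym)
    run↓-steps {x = zero} l≤m avoid (z≤n , _) x≢l = contradiction refl x≢l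

    cycle↑ : l ≤ m → Avoids l (suc m) → G m l → Cover l (suc m)
    cycle↑ {l} {m} l≤m avoid Gml = rotation l≤m , steps
      where
      steps : AllSteps Admissible (rotation l≤m)
      steps {x} x∈ with x ≟ m
      ... | yes refl = subst (Admissible m) (sym (rotation-σ-last l≤m))
                             (admissible-edge (avoid x∈) (avoid (≤-refl , s≤s l≤m)) Gml)
      ... | no x≢m   = run-steps l≤m avoid x∈ x≢m

    pair : Avoids l (2 + l) → Cover l (2 + l)
    pair {l} avoid = cycle↑ (n≤1+n l) avoid (G-pred l)

    removedPair : P l → P (suc l) → Cover l (2 + l)
    removedPair {l} Pl P1+l = rotation (n≤1+n l) , steps
      where
      steps : AllSteps Admissible (rotation (n≤1+n l))
      steps {x} x∈ with x ≟ suc l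
      ... | yes refl =
        subst (Admissible (suc l)) (sym (rotation-σ-last (n≤1+n l))) (admissible-removed P1+l Pl)
      ... | no x≢1+l = subst (Admissible x) (sym (rotation-σ-< (n≤1+n l) x<1+l))
                             (admissible-removed (subst P (sym x≡l) Pl) (subst (P ∘ suc) (sym x≡l) P1+l))
        where
        x<1+l = ≤∧≢⇒< (s≤s⁻¹ (proj₂ x∈)) x≢1+l
        x≡l = ≤-antisym (s≤s⁻¹ x<1+l) (proj₁ x∈)

    pairs : ∀ k → l + (k + k) ≡ r → Avoids l r → Cover l r
    pairs {l} zero    l+0≡r avoid = castᶜ refl (trans (sym (+-identityʳ l)) l+0≡r) (∅ᶜ l)
    pairs {l} {r} (suc k) l+2k≡r avoid =
      pair (avoids-mono ≤-refl 2+l≤r avoid) ++ᶜ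
      pairs k 2+l+k≡r (avoids-mono (m≤n+m l 2) ≤-refl avoid)
      where
      2+l+k≡r : 2 + l + (k + k) ≡ r
      2+l+k≡r = trans (shift l k) l+2k≡r
        where
        shift : ∀ l k → 2 + l + (k + k) ≡ l + (suc k + suc k)
        shift = solve-∀
      2+l≤r : 2 + l ≤ r
      2+l≤r = subst (2 + l ≤_) 2+l+k≡r (m≤m+n (2 + l) (k + k))

    module _ (p≤u : p ≤ u) (u<w : u < w) (w≤v : w ≤ v)
             (avoid₁ : Avoids p (suc u)) (inner : Cover (suc u) w) (avoid₂ : Avoids w (suc v)) where

      private
        p≤v = ≤-trans p≤u (≤-trans (<⇒≤ u<w) w≤v)
        u∈ : u ∈[ p , suc v ⟩
        u∈ = p≤u , s≤s (≤-trans (<⇒≤ u<w) w≤v)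
        v∈ : v ∈[ p , suc v ⟩
        v∈ = p≤v , n<1+n v
        w∈ : w ∈[ p , suc v ⟩
        w∈ = ≤-trans p≤u (<⇒≤ u<w) , s≤s w≤v

        p∈₁ : p ∈[ p , suc u ⟩
        p∈₁ = ≤-refl , s≤s p≤u
        u∈₁ : u ∈[ p , suc u ⟩
        u∈₁ = p≤u , ≤-refl
        w∈₂ : w ∈[ w , suc v ⟩
        w∈₂ = ≤-refl , s≤s w≤v
        v∈₂ : v ∈[ w , suc v ⟩
        v∈₂ = w≤v , ≤-refl

        π↑↑ π↑↓ : Perm p (suc v)
        π↑↑ = rotation p≤u ++ₚ proj₁ inner ++ₚ rotation w≤v
        π↑↓ = rotation p≤u ++ₚ proj₁ inner ++ₚ rotation w≤v ⁻¹

      -- The cycle p → ⋯ → u → w → ⋯ → v → p around the inner cover.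
      cycle↑↑ : G u w → G v p → Cover p (suc v)
      cycle↑↑ Guw Gvp = merge π↑↑ u∈ v∈ steps
        (subst (Admissible u) (sym σv≡w) (admissible-edge (avoid₁ u∈₁) (avoid₂ w∈₂) Guw))
        (subst (Admissible v) (sym σu≡p) (admissible-edge (avoid₂ v∈₂) (avoid₁ p∈₁) Gvp))
        where
        R : ℕ → ℕ → Set
        R x y = x ≢ u → x ≢ v → Admissible x y
        steps : ∀ {x} → x ∈[ p , suc v ⟩ → R x (σ π↑↑ x)
        steps = AllSteps-++ {R = R} (rotation p≤u) (proj₁ inner ++ₚ rotation w≤v)
          (λ x∈ x≢u _ → run-steps p≤u avoid₁ x∈ x≢u)
          (AllSteps-++ {R = R} (proj₁ inner) (rotation w≤v) (λ x∈ _ _ → proj₂ inner x∈)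
            (λ x∈ _ x≢v → run-steps w≤v avoid₂ x∈ x≢v))
        σu≡p : σ π↑↑ u ≡ p
        σu≡p = trans (++-σˡ (rotation p≤u) (proj₁ inner ++ₚ rotation w≤v) (n<1+n u))
                     (rotation-σ-last p≤u)
        σv≡w : σ π↑↑ v ≡ w
        σv≡w = trans (++-σʳ (rotation p≤u) (proj₁ inner ++ₚ rotation w≤v) (≤-trans u<w w≤v))
                     (trans (++-σʳ (proj₁ inner) (rotation w≤v) w≤v) (rotation-σ-last w≤v))

      -- The cycle p → ⋯ → u → v → ⋯ → w → p around the inner cover.
      cycle↑↓ : G u v → G w p → Cover p (suc v)
      cycle↑↓ Guv Gwp = merge π↑↓ u∈ w∈ steps
        (subst (Admissible u) (sym σw≡v) (admissible-edge (avoid₁ u∈₁) (avoid₂ v∈₂) Guv))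
        (subst (Admissible w) (sym σu≡p) (admissible-edge (avoid₂ w∈₂) (avoid₁ p∈₁) Gwp))
        where
        R : ℕ → ℕ → Set
        R x y = x ≢ u → x ≢ w → Admissible x y
        steps : ∀ {x} → x ∈[ p , suc v ⟩ → R x (σ π↑↓ x)
        steps = AllSteps-++ {R = R} (rotation p≤u) (proj₁ inner ++ₚ rotation w≤v ⁻¹)
          (λ x∈ x≢u _ → run-steps p≤u avoid₁ x∈ x≢u)
          (AllSteps-++ {R = R} (proj₁ inner) (rotation w≤v ⁻¹) (λ x∈ _ _ → proj₂ inner x∈)
            (λ x∈ _ x≢w → run↓-steps w≤v avoid₂ x∈ x≢w))
        σu≡p : σ π↑↓ u ≡ p
        σu≡p = trans (++-σˡ (rotation p≤u) (proj₁ inner ++ₚ rotation w≤v ⁻¹) (n<1+n u))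
                     (rotation-σ-last p≤u)
        σw≡v : σ π↑↓ w ≡ v
        σw≡v = trans (++-σʳ (rotation p≤u) (proj₁ inner ++ₚ rotation w≤v ⁻¹) u<w)
                     (trans (++-σʳ (proj₁ inner) (rotation w≤v ⁻¹) ≤-refl) (rotation-τ-first w≤v))

data Parity (x : ℕ) : Set where
  even : ∀ k → x ≡ k + k → Parity x
  odd  : ∀ k → x ≡ suc (k + k) → Parity x

parity : ∀ x → Parity x
parity zero = even 0 refl
parity (suc zero) = odd 0 refl
parity (suc (suc x)) with parity x
... | even k x≡ = even (suc k) (trans (cong (suc ∘ suc) x≡) (cong suc (sym (+-suc k k))))
... | odd k x≡  = odd (suc k) (trans (cong (suc ∘ suc) x≡) (cong (suc ∘ suc) (sym (+-suc k k))))

m+m≤n+n⇒m≤n : ∀ {m n} → m + m ≤ n + n → m ≤ n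
m+m≤n+n⇒m≤n {m} {n} le = subst₂ _≤_ (sym (n≡⌊n+n/2⌋ m)) (sym (n≡⌊n+n/2⌋ n)) (⌊n/2⌋-mono le)

o+o≤m+n⇒m≡o×n≡o : ∀ {m n o} → m ≤ o → n ≤ o → o + o ≤ m + n → m ≡ o × n ≡ o
o+o≤m+n⇒m≡o×n≡o {a} {b} {h} a≤h b≤h h+h≤a+b =
  ≤-antisym a≤h (+-cancelʳ-≤ h h a (≤-trans h+h≤a+b (+-monoʳ-≤ a b≤h))) ,
  ≤-antisym b≤h (+-cancelˡ-≤ h h b (≤-trans h+h≤a+b (+-monoˡ-≤ b a≤h)))

odd⇒%2≡1 : ∀ {x} k → x ≡ suc (k + k) → x % 2 ≡ 1
odd⇒%2≡1 k refl = trans (cong (_% 2) (double k)) ([m+kn]%n≡m%n 1 k 2)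
  where
  double : ∀ k → suc (k + k) ≡ 1 + k * 2
  double = solve-∀

%2≡1⇒odd : ∀ {x} → x % 2 ≡ 1 → Σ[ k ∈ ℕ ] x ≡ suc (k + k)
%2≡1⇒odd {x} x%2≡1 with parity x
... | odd k x≡  = k , x≡
... | even k refl =
  contradiction (trans (sym x%2≡1) (trans (cong (_% 2) (double k)) (m*n%n≡0 k 2))) λ ()
  where
  double : ∀ k → k + k ≡ k * 2
  double = solve-∀

%2≡1⇒≡suc-double : ∀ m → m % 2 ≡ 1 → m ≡ suc ((m ∸ 1) / 2 + (m ∸ 1) / 2)
%2≡1⇒≡suc-double m m%2≡1 with %2≡1⇒odd {m} m%2≡1
... | k , refl = cong (λ t → suc (t + t)) (sym (trans (cong (_/ 2) (double k)) (m*n/n≡m k 2)))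
  where
  double : ∀ k → k + k ≡ k * 2
  double = solve-∀

2≤odd⇒3≤ : ∀ {x} → x % 2 ≡ 1 → 2 ≤ x → 3 ≤ x
2≤odd⇒3≤ {suc zero}          _  (s≤s ())
2≤odd⇒3≤ {suc (suc zero)}    ()
2≤odd⇒3≤ {suc (suc (suc x))} _ _ = s≤s (s≤s (s≤s z≤n))

[a+c]%n≡[b+c]%n : ∀ {a b} c n .⦃ _ : NonZero n ⦄ → a % n ≡ b % n → (a + c) % n ≡ (b + c) % n
[a+c]%n≡[b+c]%n {a} {b} c n a≡b = begin
  (a + c) % n             ≡⟨ %-distribˡ-+ a c n ⟩
  (a % n + c % n) % n     ≡⟨ cong (λ t → (t + c % n) % n) a≡b ⟩
  (b % n + c % n) % n     ≡⟨ %-distribˡ-+ b c n ⟨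
  (b + c) % n             ∎
  where open ≡-Reasoning

[a+b%n]%n≡[a+b]%n : ∀ a b n .⦃ _ : NonZero n ⦄ → (a + b % n) % n ≡ (a + b) % n
[a+b%n]%n≡[a+b]%n a b n = begin
  (a + b % n) % n           ≡⟨ %-distribˡ-+ a (b % n) n ⟩
  (a % n + b % n % n) % n   ≡⟨ cong (λ t → (a % n + t) % n) (m%n%n≡m%n b n) ⟩
  (a % n + b % n) % n       ≡⟨ %-distribˡ-+ a b n ⟨
  (a + b) % n               ∎
  where open ≡-Reasoning

Removed : ℕ → ℕ → Set
Removed A x = x ≡ 0 ⊎ x ≡ 1 ⊎ x ≡ A ⊎ x ≡ suc A

module Constructions (n A s : ℕ) (G : ℕ → ℕ → Set)
  (G-suc : ∀ x → G x (suc x)) (G-sym : ∀ {x y} → G x y → G y x)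
  (G-chord : ∀ x → G x (x + s)) (G-wrap : ∀ {x y} → y + n ≡ x + s → G x y) where

  open CycleCover (Removed A) G
  open Runs G-suc (G-sym ∘ G-suc)

  private
    variable
      x : ℕ

  removed-0 : Removed A 0
  removed-0 = inj₁ refl

  removed-1 : Removed A 1
  removed-1 = inj₂ (inj₁ refl)

  removed-A : Removed A A
  removed-A = inj₂ (inj₂ (inj₁ refl))

  removed-1+A : Removed A (suc A)
  removed-1+A = inj₂ (inj₂ (inj₂ refl))

  avoids-between : Avoids 2 A
  avoids-between (s≤s (s≤s _) , _)   (inj₁ ())
  avoids-between (s≤s (s≤s _) , _)   (inj₂ (inj₁ ()))
  avoids-between (_ , x<A)           (inj₂ (inj₂ (inj₁ refl))) = <-irrefl refl x<A
  avoids-between (_ , x<A)           (inj₂ (inj₂ (inj₂ refl))) = <-asym x<A (n<1+n A)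

  removed-< : Removed A x → x < 2 + A
  removed-< (inj₁ refl)               = z<s
  removed-< (inj₂ (inj₁ refl))        = s≤s z<s
  removed-< (inj₂ (inj₂ (inj₁ refl))) = m<n+m A z<s
  removed-< (inj₂ (inj₂ (inj₂ refl))) = n<1+n (suc A)

  avoids-beyond : ∀ {l r} → 2 + A ≤ l → Avoids l r
  avoids-beyond 2+A≤l (l≤x , _) removed = <⇒≱ (removed-< removed) (≤-trans 2+A≤l l≤x)

  -- The cycle A+2 → A+3 → ⋯ → A+2+s → A+2, closed by one chord.
  chordCover : ∀ k m → A ≡ 2 + (k + k) → n ≡ 3 + A + s + (m + m) → Cover 0 n
  chordCover k m A≡ n≡ =
    removedPair removed-0 removed-1 ++ᶜ
    pairs k (sym A≡) avoids-between ++ᶜ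
    removedPair removed-A removed-1+A ++ᶜ
    cycle↑ (m≤m+n (2 + A) s) (avoids-beyond ≤-refl) (G-sym (G-chord (2 + A))) ++ᶜ
    pairs m (sym n≡) (avoids-beyond (m≤n⇒m≤1+n (m≤m+n (2 + A) s)))

  -- For s = A = (n − 1)/2: the 5-cycle 2 → 3 → A+4 → A+3 → A+2 → 2.
  halfChordCover : ∀ k → A ≡ 4 + (k + k) → s ≡ A → n ≡ suc (A + A) → Cover 0 n
  halfChordCover k A≡ s≡A n≡ =
    removedPair removed-0 removed-1 ++ᶜ
    cycle↑↓ (n≤1+n 2) (≤-trans 4≤A (m≤n+m A 2)) (m≤n+m (2 + A) 2)
      (avoids-mono ≤-refl 4≤A avoids-between) inner (avoids-beyond ≤-refl)
      (G-sym (G-wrap (trans (cong (3 +_) n≡) (cong (4 + A +_) (sym s≡A)))))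
      (G-sym (subst (λ t → G 2 (2 + t)) s≡A (G-chord 2))) ++ᶜ
    pairs k (sym n≡′) (avoids-beyond (m≤n+m (2 + A) 3))
    where
    4≤A : 4 ≤ A
    4≤A = subst (4 ≤_) (sym A≡) (m≤m+n 4 (k + k))
    inner : Cover 4 (2 + A)
    inner = pairs k (sym A≡) (avoids-mono (m≤n+m 2 2) ≤-refl avoids-between) ++ᶜ
            removedPair removed-A removed-1+A
    n≡′ : n ≡ 5 + A + (k + k)
    n≡′ = trans n≡ (trans (cong (λ t → suc (A + t)) A≡) (rearrange A (k + k)))
      where
      rearrange : ∀ a b → suc (a + (4 + b)) ≡ 5 + a + b
      rearrange = solve-∀

  -- The cycle p → ⋯ → u → u+s → ⋯ → v → v+s = p+n, whose two chords jump over
  -- the removed pairs {A, A+1} and {0, 1}; it has n − 2s + 2 vertices.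
  wrapCover : ∀ i d m → A ≡ 3 + (i + i) + d → s ≡ 3 + ((i + m) + (i + m)) → d + s + s ≤ n → Cover 0 n
  wrapCover i d m A≡ s≡ d+2s≤n with m≤n⇒∃[o]m+o≡n d+2s≤n
  ... | e , d+2s+e≡n =
    removedPair removed-0 removed-1 ++ᶜ
    pairs i refl (avoids-mono ≤-refl p≤A avoids-between) ++ᶜ
    cycle↑↑ (m≤m+n p d) (m<m+n u 0<s) (m≤m+n w e)
      (avoids-mono (m≤m+n 2 (i + i)) (≤-reflexive (sym A≡)) avoids-between)
      inner (avoids-beyond 2+A≤w) (G-chord u) (G-wrap p+n≡v+s) ++ᶜ
    pairs m (sym n≡) (avoids-beyond (≤-trans 2+A≤w (m≤n⇒m≤1+n (m≤m+n w e))))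
    where
    n≡ : n ≡ suc (2 + (i + i) + d + s + e) + (m + m)
    n≡ = trans (sym d+2s+e≡n) (trans (cong (λ t → d + s + t + e) s≡) (rearrange i d m e s))
      where
      rearrange : ∀ i d m e s →
                  d + s + (3 + ((i + m) + (i + m))) + e ≡ suc (2 + (i + i) + d + s + e) + (m + m)
      rearrange = solve-∀
    p u w v : ℕ
    p = 2 + (i + i)
    u = p + d
    w = u + s
    v = w + e
    0<s : 0 < s
    0<s = subst (0 <_) (sym s≡) z<s
    p≤A : p ≤ A
    p≤A = subst (p ≤_) (sym A≡) (m≤n⇒m≤1+n (m≤m+n p d))
    2+A+2[i+m]≡w : 2 + A + ((i + m) + (i + m)) ≡ w
    2+A+2[i+m]≡w = trans (cong (λ a → 2 + a + ((i + m) + (i + m))) A≡)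
                         (trans (rearrange u (i + m)) (cong (u +_) (sym s≡)))
      where
      rearrange : ∀ u x → 2 + suc u + (x + x) ≡ u + (3 + (x + x))
      rearrange = solve-∀
    2+A≤w : 2 + A ≤ w
    2+A≤w = subst (2 + A ≤_) 2+A+2[i+m]≡w (m≤m+n (2 + A) _)
    inner : Cover (suc u) w
    inner = castᶜ A≡ refl (removedPair removed-A removed-1+A ++ᶜ
                           pairs (i + m) 2+A+2[i+m]≡w (avoids-beyond ≤-refl))
    p+n≡v+s : p + n ≡ v + s
    p+n≡v+s = trans (cong (p +_) n≡) (trans (rearrange i m v) (cong (v +_) (sym s≡)))
      where
      rearrange : ∀ i m v → 2 + (i + i) + (suc v + (m + m)) ≡ v + (3 + ((i + m) + (i + m)))
      rearrange = solve-∀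

  -- For A = 2 both removed pairs lie in the wrapping gap of the cycle
  -- 4 → 4+s → ⋯ → 4+n−s → 4.
  wrapCover₂ : ∀ j → A ≡ 2 → s ≡ 5 + (j + j) → s + s ≤ n → Cover 0 n
  wrapCover₂ j A≡2 s≡ 2s≤n with m≤n⇒∃[o]m+o≡n 2s≤n
  ... | e , 2s+e≡n =
    removedPair removed-0 removed-1 ++ᶜ
    removedPair (subst (Removed A) A≡2 removed-A) (subst (Removed A) (cong suc A≡2) removed-1+A) ++ᶜ
    cycle↑↑ ≤-refl (m<m+n 4 0<s) (m≤m+n (4 + s) e)
      (beyond ≤-refl) inner (beyond (m≤m+n 4 s)) (G-chord 4) (G-wrap 4+n≡v+s) ++ᶜ
    pairs j (sym n≡) (beyond (m≤n⇒m≤1+n (≤-trans (m≤m+n 4 s) (m≤m+n (4 + s) e))))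
    where
    n≡ : n ≡ 5 + s + e + (j + j)
    n≡ = trans (sym 2s+e≡n) (trans (cong (λ t → t + s + e) s≡) (rearrange j s e))
      where
      rearrange : ∀ j s e → 5 + (j + j) + s + e ≡ 5 + s + e + (j + j)
      rearrange = solve-∀
    beyond : ∀ {l r} → 4 ≤ l → Avoids l r
    beyond 4≤l = avoids-beyond (subst (λ a → 2 + a ≤ _) (sym A≡2) 4≤l)
    0<s : 0 < s
    0<s = subst (0 <_) (sym s≡) z<s
    inner : Cover 5 (4 + s)
    inner = pairs (2 + j) (trans (rearrange j) (cong (4 +_) (sym s≡))) (beyond (n≤1+n 4))
      where
      rearrange : ∀ j → 5 + ((2 + j) + (2 + j)) ≡ 4 + (5 + (j + j))
      rearrange = solve-∀
    4+n≡v+s : 4 + n ≡ 4 + s + e + s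
    4+n≡v+s = trans (cong (4 +_) n≡) (trans (rearrange s e j) (cong (4 + s + e +_) (sym s≡)))
      where
      rearrange : ∀ s e j → 4 + (5 + s + e + (j + j)) ≡ 4 + s + e + (5 + (j + j))
      rearrange = solve-∀

  module _ (h : ℕ) (n≡ : n ≡ suc (h + h))
           (2≤A : 2 ≤ A) (A≤h : A ≤ h) (2≤s : 2 ≤ s) (s≤h : s ≤ h) where

    private
      suc-double : ∀ i → suc (suc i + suc i) ≡ 3 + (i + i)
      suc-double i = cong (suc ∘ suc) (+-suc i i)

      2s≤2h : s + s ≤ h + h
      2s≤2h = +-mono-≤ s≤h s≤h

      2h<n : h + h < n
      2h<n = ≤-reflexive (sym n≡)

      2s≤n : s + s ≤ n
      2s≤n = ≤-trans 2s≤2h (<⇒≤ 2h<n)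

      s-shape : ∀ {i m j} → suc i + m ≡ j → s ≡ suc (j + j) → s ≡ 3 + ((i + m) + (i + m))
      s-shape {i} {m} j≡ s≡ = trans s≡ (trans (cong (λ t → suc (t + t)) (sym j≡)) (suc-double (i + m)))

      -- s ≤ A: the cycle's first run is [s − 1, A − 1].
      wrapCover-below : ∀ i → s ≡ suc (suc i + suc i) → s ≤ A → Cover 0 n
      wrapCover-below i s≡ s≤A with m≤n⇒∃[o]m+o≡n s≤A
      ... | d , s+d≡A = wrapCover i d 0 A≡ s≡′ d+2s≤n
        where
        A≡ : A ≡ 3 + (i + i) + d
        A≡ = trans (sym s+d≡A) (cong (_+ d) (trans s≡ (suc-double i)))
        s≡′ : s ≡ 3 + ((i + 0) + (i + 0))
        s≡′ = trans s≡ (trans (suc-double i) (cong (λ t → 3 + (t + t)) (sym (+-identityʳ i))))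
        d+2s≤n : d + s + s ≤ n
        d+2s≤n = subst (λ t → t + s ≤ n) (trans (sym s+d≡A) (+-comm s d))
                       (≤-trans (+-monoˡ-≤ s A≤h) (≤-trans (+-monoʳ-≤ h s≤h) (<⇒≤ 2h<n)))

      -- A < s: the cycle's first run is [A − 1, A − 1] or [A − 2, A − 1], whichever starts even.
      wrapCover-above : 3 ≤ A → A < s → ∀ j → s ≡ suc (j + j) → Cover 0 n
      wrapCover-above 3≤A A<s j s≡ with parity A
      ... | even zero A≡       = contradiction (subst (3 ≤_) A≡ 3≤A) λ ()
      ... | even (suc zero) A≡ = contradiction (subst (3 ≤_) A≡ 3≤A) λ { (s≤s (s≤s ())) }
      ... | odd zero A≡        = contradiction (subst (3 ≤_) A≡ 3≤A) λ { (s≤s ()) }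
      ... | odd (suc i) A≡
        with m≤n⇒∃[o]m+o≡n (m+m≤n+n⇒m≤n {suc i} {j} (s≤s⁻¹ (<⇒≤ (subst₂ _<_ A≡ s≡ A<s))))
      ...   | m , j≡ = wrapCover i 0 m (trans A≡ (trans (suc-double i) (sym (+-identityʳ _))))
                                     (s-shape {i} {m} j≡ s≡) 2s≤n
      wrapCover-above 3≤A A<s j s≡ | even (suc (suc i)) A≡
        with m≤n⇒∃[o]m+o≡n (≤-trans (n≤1+n (suc i))
                                    (m+m≤n+n⇒m≤n {suc (suc i)} {j} (s≤s⁻¹ (subst₂ _<_ A≡ s≡ A<s))))
      ... | m , j≡ =
        wrapCover i 1 m (trans A≡ (rearrange i)) (s-shape {i} {m} j≡ s≡) (≤-trans (s≤s 2s≤2h) 2h<n)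
        where
        rearrange : ∀ i → suc (suc i) + suc (suc i) ≡ 3 + (i + i) + 1
        rearrange = solve-∀

    oddJumpCover : 3 ≤ A → ∀ j → s ≡ suc (j + j) → Cover 0 n
    oddJumpCover 3≤A zero s≡ = contradiction (subst (2 ≤_) s≡ 2≤s) λ { (s≤s ()) }
    oddJumpCover 3≤A (suc i) s≡ with s ≤? A
    ... | yes s≤A = wrapCover-below i s≡ s≤A
    ... | no s≰A  = wrapCover-above 3≤A (≰⇒> s≰A) (suc i) s≡

    private
      too-long⇒h+h≤A+s : ∀ k j → A ≡ suc k + suc k → s ≡ j + j → ¬ suc (suc k + j) ≤ h → h + h ≤ A + s
      too-long⇒h+h≤A+s k j A≡ s≡ k+j≮h = subst (h + h ≤_) (shape A≡ s≡) (+-mono-≤ h≤k+j h≤k+j)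
        where
        h≤k+j : h ≤ suc k + j
        h≤k+j = s≤s⁻¹ (≰⇒> k+j≮h)
        shape : ∀ {A s} → A ≡ suc k + suc k → s ≡ j + j → (suc k + j) + (suc k + j) ≡ A + s
        shape refl refl = solve (k ∷ j ∷ [])

    -- The hypotheses on s matter only for A = 2: the cycle of wrapCover₂ needs s ≥ 5, and
    -- s = 2 = h would mean n = 5, where Γ − U is a single vertex.
    evenCover : ∀ k → A ≡ k + k → s ≢ 3 → (s ≡ 2 → 3 ≤ h) → Cover 0 n
    evenCover k A≡ s≢3 s≡2⇒3≤h with parity s
    evenCover zero A≡ _ _ | _ = contradiction (subst (2 ≤_) A≡ 2≤A) λ ()
    evenCover (suc (suc k)) A≡ _ _ | odd j s≡ = oddJumpCover 3≤A j s≡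
      where
      3≤A : 3 ≤ A
      3≤A = subst (3 ≤_) (sym A≡) (s≤s (s≤s (≤-trans (s≤s z≤n) (m≤n+m (suc (suc k)) k))))
    evenCover (suc zero) A≡ s≢3 _ | odd zero s≡ = contradiction (subst (2 ≤_) s≡ 2≤s) λ { (s≤s ()) }
    evenCover (suc zero) A≡ s≢3 _ | odd (suc zero) s≡ = contradiction s≡ s≢3
    evenCover (suc zero) A≡ s≢3 _ | odd (suc (suc j)) s≡ = wrapCover₂ j A≡ (trans s≡ (rearrange j)) 2s≤n
      where
      rearrange : ∀ j → suc (suc (suc j) + suc (suc j)) ≡ 5 + (j + j)
      rearrange = solve-∀
    evenCover (suc k) A≡ _ s≡2⇒3≤h | even j s≡ with suc (suc k + j) ≤? h
    ... | yes k+j<h with m≤n⇒∃[o]m+o≡n k+j<h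
    ...   | m , h≡ = chordCover k m (trans A≡ (cong suc (+-suc k k))) (shape n≡ A≡ s≡ h≡)
      where
      shape : ∀ {n h A s} → n ≡ suc (h + h) → A ≡ suc k + suc k → s ≡ j + j → suc (suc k + j) + m ≡ h →
              n ≡ 3 + A + s + (m + m)
      shape refl refl refl refl = solve (k ∷ j ∷ m ∷ [])
    evenCover (suc k) A≡ _ _ | even j s≡ | no k+j≮h with o+o≤m+n⇒m≡o×n≡o A≤h s≤h (too-long⇒h+h≤A+s k j A≡ s≡ k+j≮h)
    evenCover (suc zero) A≡ _ s≡2⇒3≤h | even j s≡ | no _ | A≡h , s≡h =
      contradiction (s≡2⇒3≤h (trans s≡h (trans (sym A≡h) A≡)))
                    (subst (λ t → ¬ 3 ≤ t) (trans (sym A≡) A≡h) λ { (s≤s (s≤s ())) })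
    evenCover (suc (suc k)) A≡ _ _ | even j s≡ | no _ | A≡h , s≡h =
      halfChordCover k (trans A≡ (rearrange k)) (trans s≡h (sym A≡h))
                       (trans n≡ (cong (λ t → suc (t + t)) (sym A≡h)))
      where
      rearrange : ∀ k → suc (suc k) + suc (suc k) ≡ 4 + (k + k)
      rearrange = solve-∀

module Circulant {n : ℕ} ⦃ _ : NonZero n ⦄ (S : Subset n) (⊝-closed : ∀ t → t ∈ S → ⊝ t ∈ S) where

  open IntervalPermutation using (_∈[_,_⟩; σ; τ; σ-∈; τ-∈; σ-τ; τ-σ)

  private
    variable
      x y : ℕ

  Step : ℕ → ℕ → Set
  Step x y = Σ[ t ∈ Fin n ] t ∈ S × y % n ≡ (x + toℕ t) % n

  Step-sym : Step x y → Step y x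
  Step-sym {x} {y} (t , t∈S , y≡x+t) = ⊝ t , ⊝-closed t t∈S , sym (begin
    (y + toℕ (⊝ t)) % n          ≡⟨ cong (λ u → (y + u) % n) (toℕ-fromℕ< _) ⟩
    (y + (n ∸ toℕ t) % n) % n    ≡⟨ [a+b%n]%n≡[a+b]%n y (n ∸ toℕ t) n ⟩
    (y + (n ∸ toℕ t)) % n        ≡⟨ [a+c]%n≡[b+c]%n (n ∸ toℕ t) n y≡x+t ⟩
    (x + toℕ t + (n ∸ toℕ t)) % n ≡⟨ cong (_% n) (+-assoc x (toℕ t) _) ⟩
    (x + (toℕ t + (n ∸ toℕ t))) % n ≡⟨ cong (λ u → (x + u) % n) (m+[n∸m]≡n (<⇒≤ (toℕ<n t))) ⟩
    (x + n) % n                  ≡⟨ [m+n]%n≡m%n x n ⟩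
    x % n                        ∎)
    where open ≡-Reasoning

  Step-chord : ∀ {t} → t ∈ S → ∀ x → Step x (x + toℕ t)
  Step-chord t∈S x = _ , t∈S , refl

  Step-wrap : ∀ {t} → t ∈ S → y + n ≡ x + toℕ t → Step x y
  Step-wrap {y} t∈S y+n≡x+t = _ , t∈S , trans (sym ([m+n]%n≡m%n y n)) (cong (_% n) y+n≡x+t)

  Step⇒Adj : ∀ {v w} → Step (toℕ v) (toℕ w) → Adj S v w
  Step⇒Adj {v} {w} (t , t∈S , w≡v+t) = inj₁ (subst (_∈ S) (sym (toℕ-injective w⊖v≡t)) t∈S)
    where
    open ≡-Reasoning
    w⊖v≡t : toℕ (w ⊖ v) ≡ toℕ t
    w⊖v≡t = begin
      toℕ (w ⊖ v)                             ≡⟨ toℕ-fromℕ< _ ⟩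
      (toℕ w + (n ∸ toℕ v)) % n               ≡⟨ [a+c]%n≡[b+c]%n (n ∸ toℕ v) n w≡v+t ⟩
      (toℕ v + toℕ t + (n ∸ toℕ v)) % n       ≡⟨ cong (_% n) (rearrange (toℕ v) (toℕ t) (<⇒≤ (toℕ<n v))) ⟩
      (toℕ t + n) % n                         ≡⟨ [m+n]%n≡m%n (toℕ t) n ⟩
      toℕ t % n                               ≡⟨ m<n⇒m%n≡m (toℕ<n t) ⟩
      toℕ t                                   ∎
      where
      rearrange : ∀ a b → a ≤ n → a + b + (n ∸ a) ≡ b + n
      rearrange a b a≤n = trans (+-assoc a b (n ∸ a)) (trans (cong (a +_) (+-comm b (n ∸ a)))
        (trans (sym (+-assoc a (n ∸ a) b)) (trans (cong (_+ b) (m+[n∸m]≡n a≤n)) (+-comm n b))))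

  module _ (U : Subset n) (P : ℕ → Set)
    (∈U⇒P : ∀ {v} → v ∈ U → P (toℕ v)) (P⇒∈U : ∀ {v} → P (toℕ v) → v ∈ U) where

    open CycleCover P Step using (Cover)

    cover⇒HasFPM : Cover 0 n → HasFPM n S U
    cover⇒HasFPM (π , admissible) =
      FractionalMatching.cycleCover⇒HasFPM S U σ′ τ′ σ′∘τ′ τ′∘σ′ σ′-∈U σ′-∉U σ′-Adj
      where
      ∈[0,n⟩ : (v : Fin n) → toℕ v ∈[ 0 , n ⟩
      ∈[0,n⟩ v = z≤n , toℕ<n v
      σ′ τ′ : Fin n → Fin n
      σ′ v = fromℕ< (proj₂ (σ-∈ π (∈[0,n⟩ v)))
      τ′ v = fromℕ< (proj₂ (τ-∈ π (∈[0,n⟩ v)))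
      toℕ-σ′ : ∀ v → toℕ (σ′ v) ≡ σ π (toℕ v)
      toℕ-σ′ v = toℕ-fromℕ< _
      toℕ-τ′ : ∀ v → toℕ (τ′ v) ≡ τ π (toℕ v)
      toℕ-τ′ v = toℕ-fromℕ< _
      σ′∘τ′ : ∀ v → σ′ (τ′ v) ≡ v
      σ′∘τ′ v = toℕ-injective (trans (toℕ-σ′ (τ′ v)) (trans (cong (σ π) (toℕ-τ′ v)) (σ-τ π (∈[0,n⟩ v))))
      τ′∘σ′ : ∀ v → τ′ (σ′ v) ≡ v
      τ′∘σ′ v = toℕ-injective (trans (toℕ-τ′ (σ′ v)) (trans (cong (τ π) (toℕ-σ′ v)) (τ-σ π (∈[0,n⟩ v))))
      ¬P : ∀ {v} → v ∉ U → ¬ P (toℕ v)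
      ¬P v∉U = v∉U ∘ P⇒∈U
      σ′-∈U : ∀ {v} → v ∈ U → σ′ v ∈ U
      σ′-∈U {v} v∈U = P⇒∈U (subst P (sym (toℕ-σ′ v)) (proj₁ (admissible (∈[0,n⟩ v)) (∈U⇒P v∈U)))
      σ′-∉U : ∀ {v} → v ∉ U → σ′ v ∉ U
      σ′-∉U {v} v∉U σ′v∈U =
        proj₁ (proj₂ (admissible (∈[0,n⟩ v)) (¬P v∉U)) (subst P (toℕ-σ′ v) (∈U⇒P σ′v∈U))
      σ′-Adj : ∀ {v} → v ∉ U → Adj S v (σ′ v)
      σ′-Adj {v} v∉U =
        Step⇒Adj (subst (Step (toℕ v)) (sym (toℕ-σ′ v)) (proj₂ (proj₂ (admissible (∈[0,n⟩ v)) (¬P v∉U))))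

module SubsetCardinality where

  open import Data.Bool.Base using (true; false)
  open import Data.Vec.Base using ([]; _∷_)

  ∣p∪q∣≤∣p∣+∣q∣ : ∀ {n} (p q : Subset n) → ∣ p ∪ q ∣ ≤ ∣ p ∣ + ∣ q ∣
  ∣p∪q∣≤∣p∣+∣q∣ []          []          = z≤n
  ∣p∪q∣≤∣p∣+∣q∣ (true ∷ p)  (true ∷ q)  =
    s≤s (≤-trans (∣p∪q∣≤∣p∣+∣q∣ p q) (≤-trans (n≤1+n _) (≤-reflexive (sym (+-suc ∣ p ∣ ∣ q ∣)))))
  ∣p∪q∣≤∣p∣+∣q∣ (true ∷ p)  (false ∷ q) = s≤s (∣p∪q∣≤∣p∣+∣q∣ p q)
  ∣p∪q∣≤∣p∣+∣q∣ (false ∷ p) (true ∷ q)  =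
    ≤-trans (s≤s (∣p∪q∣≤∣p∣+∣q∣ p q)) (≤-reflexive (sym (+-suc ∣ p ∣ ∣ q ∣)))
  ∣p∪q∣≤∣p∣+∣q∣ (false ∷ p) (false ∷ q) = ∣p∪q∣≤∣p∣+∣q∣ p q

  ∣⁅x⁆∪⁅y⁆∣≤2 : ∀ {n} (x y : Fin n) → ∣ ⁅ x ⁆ ∪ ⁅ y ⁆ ∣ ≤ 2
  ∣⁅x⁆∪⁅y⁆∣≤2 x y = ≤-trans (∣p∪q∣≤∣p∣+∣q∣ ⁅ x ⁆ ⁅ y ⁆) (≤-reflexive (cong₂ _+_ (∣⁅x⁆∣≡1 x) (∣⁅x⁆∣≡1 y)))

  ∣p∣<∣q∣⇒∃∈q∉p : ∀ {n} (p q : Subset n) → ∣ p ∣ < ∣ q ∣ → Σ[ x ∈ Fin n ] x ∈ q × x ∉ p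
  ∣p∣<∣q∣⇒∃∈q∉p p q ∣p∣<∣q∣ with any? (λ x → (x ∈? q) ×-dec ¬? (x ∈? p))
  ... | yes witness = witness
  ... | no none     = contradiction (p⊆q⇒∣p∣≤∣q∣ q⊆p) (<⇒≱ ∣p∣<∣q∣)
    where
    q⊆p : ∀ {x} → x ∈ q → x ∈ p
    q⊆p {x} x∈q with x ∈? p
    ... | yes x∈p = x∈p
    ... | no x∉p  = contradiction (x , x∈q , x∉p) none

open SubsetCardinality

toℕ≡⇒∈ : ∀ {n} {p : Subset n} {v w} → toℕ v ≡ toℕ w → w ∈ p → v ∈ p
toℕ≡⇒∈ {p = p} v≡w w∈p = subst (_∈ p) (sym (toℕ-injective v≡w)) w∈p

module Setting (n : ℕ) ⦃ _ : NonZero n ⦄ (5≤n : 5 ≤ n) (n-odd : n % 2 ≡ 1)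
  (S : Subset n) (0∉S : [ 0 ]ₙ ∉ S) (⊝-closed : ∀ s → s ∈ S → ⊝ s ∈ S) (1∈S : [ 1 ]ₙ ∈ S)
  (a : Fin n) (2≤A : 2 ≤ toℕ a) (A≤h : toℕ a ≤ (n ∸ 1) / 2) where

  open Circulant S ⊝-closed

  h A : ℕ
  h = (n ∸ 1) / 2
  A = toℕ a

  n≡ : n ≡ suc (h + h)
  n≡ = %2≡1⇒≡suc-double n n-odd

  private
    toℕ-[_] : ∀ {k} → k < n → toℕ ([_]ₙ {n} k) ≡ k
    toℕ-[ k<n ] = trans (toℕ-fromℕ< _) (m<n⇒m%n≡m k<n)

    toℕ-⊝ : ∀ {t} → 0 < toℕ t → toℕ (⊝ t) ≡ n ∸ toℕ t
    toℕ-⊝ {t} 0<t = trans (toℕ-fromℕ< _) (m<n⇒m%n≡m (∸-monoʳ-< 0<t (<⇒≤ (toℕ<n t))))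

    toℕ-small : ∀ k → k < 5 → toℕ ([_]ₙ {n} k) ≡ k
    toℕ-small k k<5 = toℕ-[ <-≤-trans k<5 5≤n ]

    toℕ-⊝small : ∀ k → 0 < k → k < 5 → toℕ (⊝ ([_]ₙ {n} k)) ≡ n ∸ k
    toℕ-⊝small k 0<k k<5 =
      trans (toℕ-⊝ (subst (0 <_) (sym (toℕ-small k k<5)) 0<k)) (cong (n ∸_) (toℕ-small k k<5))

    1+A<n : suc A < n
    1+A<n = subst (suc A <_) (sym n≡) (s≤s (subst (_≤ h + h) (+-comm A 1) (+-mono-≤ A≤h 1≤h)))
      where
      1≤h : 1 ≤ h
      1≤h = ≤-trans (s≤s z≤n) (≤-trans 2≤A A≤h)

  U : Subset n
  U = ⁅ [ 0 ]ₙ ⁆ ∪ ⁅ [ 1 ]ₙ ⁆ ∪ ⁅ a ⁆ ∪ ⁅ a ⊕ [ 1 ]ₙ ⁆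

  toℕ-a⊕1 : toℕ (a ⊕ [ 1 ]ₙ) ≡ suc A
  toℕ-a⊕1 = trans (toℕ-fromℕ< _) (trans (cong (λ t → (A + t) % n) (toℕ-small 1 (s≤s z<s)))
                                        (trans (cong (_% n) (+-comm A 1)) (m<n⇒m%n≡m 1+A<n)))

  ∈U⇒removed : ∀ {v} → v ∈ U → Removed A (toℕ v)
  ∈U⇒removed v∈U with x∈p∪q⁻ _ _ v∈U
  ... | inj₁ v∈0 = inj₁ (trans (cong toℕ (x∈⁅y⁆⇒x≡y _ v∈0)) (toℕ-small 0 z<s))
  ... | inj₂ v∈U′ with x∈p∪q⁻ _ _ v∈U′
  ...   | inj₁ v∈1 = inj₂ (inj₁ (trans (cong toℕ (x∈⁅y⁆⇒x≡y _ v∈1)) (toℕ-small 1 (s≤s z<s))))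
  ...   | inj₂ v∈U″ with x∈p∪q⁻ _ _ v∈U″
  ...     | inj₁ v∈a   = inj₂ (inj₂ (inj₁ (cong toℕ (x∈⁅y⁆⇒x≡y _ v∈a))))
  ...     | inj₂ v∈a⊕1 = inj₂ (inj₂ (inj₂ (trans (cong toℕ (x∈⁅y⁆⇒x≡y _ v∈a⊕1)) toℕ-a⊕1)))

  removed⇒∈U : ∀ {v} → Removed A (toℕ v) → v ∈ U
  removed⇒∈U (inj₁ v≡0) =
    x∈p∪q⁺ (inj₁ (toℕ≡⇒∈ (trans v≡0 (sym (toℕ-small 0 z<s))) (x∈⁅x⁆ _)))
  removed⇒∈U (inj₂ (inj₁ v≡1)) =
    x∈p∪q⁺ (inj₂ (x∈p∪q⁺ (inj₁ (toℕ≡⇒∈ (trans v≡1 (sym (toℕ-small 1 (s≤s z<s)))) (x∈⁅x⁆ _)))))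
  removed⇒∈U (inj₂ (inj₂ (inj₁ v≡A))) =
    x∈p∪q⁺ (inj₂ (x∈p∪q⁺ (inj₂ (x∈p∪q⁺ (inj₁ (toℕ≡⇒∈ v≡A (x∈⁅x⁆ _)))))))
  removed⇒∈U (inj₂ (inj₂ (inj₂ v≡1+A))) =
    x∈p∪q⁺ (inj₂ (x∈p∪q⁺ (inj₂ (x∈p∪q⁺ (inj₂ (toℕ≡⇒∈ (trans v≡1+A (sym toℕ-a⊕1)) (x∈⁅x⁆ _)))))))

  Step-suc : ∀ x → Step x (suc x)
  Step-suc x = subst (Step x) (trans (cong (x +_) (toℕ-small 1 (s≤s z<s))) (+-comm x 1)) (Step-chord 1∈S x)

  module _ {s : Fin n} (s∈S : s ∈ S) (2≤s : 2 ≤ toℕ s) (s≤h : toℕ s ≤ h) where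

    open Constructions n A (toℕ s) Step Step-suc Step-sym (Step-chord s∈S) (Step-wrap s∈S)

    private
      fpm : CycleCover.Cover (Removed A) Step 0 n → HasFPM n S U
      fpm = cover⇒HasFPM U (Removed A) ∈U⇒removed removed⇒∈U

    evenFPM : ∀ k → A ≡ k + k → toℕ s ≢ 3 → (toℕ s ≡ 2 → 3 ≤ h) → HasFPM n S U
    evenFPM k A≡ s≢3 s≡2⇒3≤h = fpm (evenCover h n≡ 2≤A A≤h 2≤s s≤h k A≡ s≢3 s≡2⇒3≤h)

    oddJumpFPM : 3 ≤ A → ∀ j → toℕ s ≡ suc (j + j) → HasFPM n S U
    oddJumpFPM 3≤A j s≡ = fpm (oddJumpCover h n≡ 2≤A A≤h 2≤s s≤h 3≤A j s≡)

  Jump : Fin n → Set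
  Jump s = s ∈ S × 2 ≤ toℕ s × toℕ s ≤ h

  jump-from : ∀ {t} → t ∈ S → toℕ t ≢ 1 → toℕ t ≢ n ∸ 1 →
              Σ[ s ∈ Fin n ] Jump s × (toℕ s ≡ toℕ t ⊎ toℕ s + toℕ t ≡ n)
  jump-from {t} t∈S t≢1 t≢n-1 with toℕ t ≤? h
  ... | yes t≤h = t , (t∈S , 2≤t , t≤h) , inj₁ refl
    where
    2≤t : 2 ≤ toℕ t
    2≤t with toℕ t in t≡
    ... | zero        = contradiction (toℕ≡⇒∈ (trans (toℕ-small 0 z<s) (sym t≡)) t∈S) 0∉S
    ... | suc zero    = contradiction refl t≢1
    ... | suc (suc _) = s≤s (s≤s z≤n)
  ... | no t≰h = ⊝ t , (⊝-closed t t∈S , 2≤n-t , n-t≤h) , inj₂ n-t+t≡n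
    where
    h<t : h < toℕ t
    h<t = ≰⇒> t≰h
    toℕ-⊝t : toℕ (⊝ t) ≡ n ∸ toℕ t
    toℕ-⊝t = toℕ-⊝ (≤-<-trans z≤n h<t)
    2≤n-t : 2 ≤ toℕ (⊝ t)
    2≤n-t = subst (2 ≤_) (sym toℕ-⊝t) (m+n≤o⇒m≤o∸n 2 (≤∧≢⇒< (toℕ<n t) (t≢n-1 ∘ cong (_∸ 1))))
    n-t≤h : toℕ (⊝ t) ≤ h
    n-t≤h = subst (_≤ h) (sym toℕ-⊝t)
                  (m≤n+o⇒m∸n≤o n (toℕ t) (subst (_≤ toℕ t + h) (sym n≡) (+-monoˡ-≤ h h<t)))
    n-t+t≡n : toℕ (⊝ t) + toℕ t ≡ n
    n-t+t≡n = trans (cong (_+ toℕ t) toℕ-⊝t) (m∸n+n≡m (<⇒≤ (toℕ<n t)))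

  jump-avoiding : (L : Subset n) → [ 1 ]ₙ ∈ L → ⊝ [ 1 ]ₙ ∈ L → ∣ L ∣ < ∣ S ∣ →
    Σ[ s ∈ Fin n ] Jump s × Σ[ t ∈ Fin n ] t ∉ L × (toℕ s ≡ toℕ t ⊎ toℕ s + toℕ t ≡ n)
  jump-avoiding L 1∈L -1∈L ∣L∣<∣S∣ =
    let t , t∈S , t∉L = ∣p∣<∣q∣⇒∃∈q∉p L S ∣L∣<∣S∣
        s , jump , s~t = jump-from t∈S
          (λ t≡1 → t∉L (toℕ≡⇒∈ (trans t≡1 (sym (toℕ-small 1 (s≤s z<s)))) 1∈L))
          (λ t≡n-1 → t∉L (toℕ≡⇒∈ (trans t≡n-1 (sym (toℕ-⊝small 1 z<s (s≤s z<s)))) -1∈L))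
    in s , jump , t , t∉L , s~t

  ±1 ±1±3 : Subset n
  ±1 = ⁅ [ 1 ]ₙ ⁆ ∪ ⁅ ⊝ [ 1 ]ₙ ⁆
  ±1±3 = ±1 ∪ (⁅ [ 3 ]ₙ ⁆ ∪ ⁅ ⊝ [ 3 ]ₙ ⁆)

  private
    ∣±1∣≤2 : ∣ ±1 ∣ ≤ 2
    ∣±1∣≤2 = ∣⁅x⁆∪⁅y⁆∣≤2 ([_]ₙ {n} 1) _

    ∣±1±3∣≤4 : ∣ ±1±3 ∣ ≤ 4
    ∣±1±3∣≤4 = ≤-trans (∣p∪q∣≤∣p∣+∣q∣ ±1 _) (+-mono-≤ ∣±1∣≤2 (∣⁅x⁆∪⁅y⁆∣≤2 ([_]ₙ {n} 3) _))

  evenJump : 4 ≤ ∣ S ∣ → ([ 2 ]ₙ ∉ S × [ 3 ]ₙ ∉ S) ⊎ 6 ≤ ∣ S ∣ →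
             Σ[ s ∈ Fin n ] Jump s × toℕ s ≢ 3 × (toℕ s ≡ 2 → 3 ≤ h)
  evenJump 4≤∣S∣ (inj₁ (2∉S , 3∉S))
    with jump-avoiding ±1 (x∈p∪q⁺ (inj₁ (x∈⁅x⁆ _))) (x∈p∪q⁺ (inj₂ (x∈⁅x⁆ _)))
                       (≤-trans (s≤s ∣±1∣≤2) (≤-trans (n≤1+n 3) 4≤∣S∣))
  ... | s , jump@(s∈S , _ , _) , _ = s , jump , s≢3 , s≡2⇒3≤h
    where
    s≢3 : toℕ s ≢ 3
    s≢3 s≡3 = 3∉S (toℕ≡⇒∈ (trans (toℕ-small 3 (s≤s (s≤s (s≤s z<s)))) (sym s≡3)) s∈S)
    s≡2⇒3≤h : toℕ s ≡ 2 → 3 ≤ h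
    s≡2⇒3≤h s≡2 = contradiction (toℕ≡⇒∈ (trans (toℕ-small 2 (s≤s (s≤s z<s))) (sym s≡2)) s∈S) 2∉S
  evenJump _ (inj₂ 6≤∣S∣)
    with jump-avoiding ±1±3 (x∈p∪q⁺ (inj₁ (x∈p∪q⁺ (inj₁ (x∈⁅x⁆ _)))))
                            (x∈p∪q⁺ (inj₁ (x∈p∪q⁺ (inj₂ (x∈⁅x⁆ _)))))
                            (≤-trans (s≤s ∣±1±3∣≤4) (≤-trans (n≤1+n 5) 6≤∣S∣))
  ... | s , jump , t , t∉±1±3 , s~t = s , jump , s≢3 , λ _ → 3≤h
    where
    s≢3 : toℕ s ≢ 3
    s≢3 s≡3 = t∉±1±3 (x∈p∪q⁺ (inj₂ (t∈±3 s~t)))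
      where
      toℕ-3 = toℕ-small 3 (s≤s (s≤s (s≤s z<s)))
      t∈±3 : toℕ s ≡ toℕ t ⊎ toℕ s + toℕ t ≡ n → t ∈ ⁅ [ 3 ]ₙ ⁆ ∪ ⁅ ⊝ [ 3 ]ₙ ⁆
      t∈±3 (inj₁ s≡t)   = x∈p∪q⁺ (inj₁ (toℕ≡⇒∈ (trans (sym s≡t) (trans s≡3 (sym toℕ-3))) (x∈⁅x⁆ _)))
      t∈±3 (inj₂ s+t≡n) = x∈p∪q⁺ (inj₂ (toℕ≡⇒∈ t≡n-3 (x∈⁅x⁆ _)))
        where
        t≡n-3 : toℕ t ≡ toℕ (⊝ [ 3 ]ₙ)
        t≡n-3 = trans (sym (m+n∸m≡n 3 (toℕ t)))
                (trans (cong (λ u → u + toℕ t ∸ 3) (sym s≡3))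
                (trans (cong (_∸ 3) s+t≡n) (sym (toℕ-⊝small 3 z<s (s≤s (s≤s (s≤s (s≤s z≤n))))))))
    3≤h : 3 ≤ h
    3≤h = ≮⇒≥ λ h<3 → <⇒≱ (s≤s (s≤s (+-mono-≤ (s≤s⁻¹ h<3) (s≤s⁻¹ h<3))))
                           (subst (6 ≤_) n≡ (≤-trans 6≤∣S∣ (∣p∣≤n S)))

lemma3p8 : (n : ℕ) ⦃ _ : NonZero n ⦄ → 5 ≤ n → n % 2 ≡ 1 →
    (S : Subset n) → [ 0 ]ₙ ∉ S → (∀ s → s ∈ S → (⊝ s) ∈ S) → [ 1 ]ₙ ∈ S →
    4 ≤ ∣ S ∣ → (([ 2 ]ₙ ∉ S × [ 3 ]ₙ ∉ S) ⊎ 6 ≤ ∣ S ∣) →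
    (a : Fin n) → 2 ≤ toℕ a → toℕ a ≤ (n ∸ 1) / 2 →
    ¬ HasFPM n S (⁅ [ 0 ]ₙ ⁆ ∪ ⁅ [ 1 ]ₙ ⁆ ∪ ⁅ a ⁆ ∪ ⁅ a ⊕ [ 1 ]ₙ ⁆) →
    (toℕ a % 2 ≡ 1) ×
    ¬ (∃ λ (s : Fin n) → s ∈ S × toℕ s % 2 ≡ 1 × 1 < toℕ s × toℕ s ≤ (n ∸ 1) / 2)
lemma3p8 n 5≤n n-odd S 0∉S ⊝-closed 1∈S 4≤∣S∣ small-S a 2≤a a≤h no-fpm = a-odd , no-odd-jump
  where
  open Setting n 5≤n n-odd S 0∉S ⊝-closed 1∈S a 2≤a a≤h

  a-odd : toℕ a % 2 ≡ 1
  a-odd with parity (toℕ a)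
  ... | odd k a≡  = odd⇒%2≡1 k a≡
  ... | even k a≡ with evenJump 4≤∣S∣ small-S
  ...   | s , (s∈S , 2≤s , s≤h) , s≢3 , s≡2⇒3≤h =
    contradiction (evenFPM s∈S 2≤s s≤h k a≡ s≢3 s≡2⇒3≤h) no-fpm

  no-odd-jump : ¬ (∃ λ (s : Fin n) → s ∈ S × toℕ s % 2 ≡ 1 × 1 < toℕ s × toℕ s ≤ (n ∸ 1) / 2)
  no-odd-jump (s , s∈S , s-odd , 1<s , s≤h) =
    let j , s≡ = %2≡1⇒odd s-odd in
    no-fpm (oddJumpFPM s∈S 1<s s≤h (2≤odd⇒3≤ a-odd 2≤a) j s≡)
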